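{- If $G$ is an outerplanar graph with maximum degree $\Delta(G)\geq 2$, then $\chi^d_i(G)=\Delta(G)$ for every integer $d\geq 2$.
   Context: All graphs are simple. An outerplanar graph is a graph that can be embedded in the plane with all vertices on the outer face. For a graph $G$, an incidence is a pair $(v,e)$ with $v\in V(G)$ an endpoint of the edge $e\in E(G)$; $I(G)$ is the set of all incidences. For $u\in V(G)$ and a neighbor $v$ of $u$, $(u,uv)$ is a strong incidence of $u$ and $(v,uv)$ is a weak incidence of $u$; $I_u$ and $A_u$ denote the sets of strong and weak incidences of $u$. For a map $\varphi$ on $I(G)$, $\varphi(I_u)=\{\varphi(u,uv): v\in N_G(u)\}$. Let $[k]=\{1,\dots,k\}$. A $d$-defective incidence $k$-coloring of $G$ is a map $\varphi: I(G)\to[k]$ such that for every $u\in V(G)$: (a) $\varphi(u,uv)\neq\varphi(u,uw)$ for distinct $v,w\in N_G(u)$; (b) $\varphi(u,uv)\neq\varphi(v,uv)$ for every $v\in N_G(u)$; (c) every color in $\varphi(I_u)$ appears at most $d$ times among the incidences of $A_u$. $\chi^d_i(G)$ is the minimum $k$ such that $G$ has a $d$-defective incidence $k$-coloring. -}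

module Defs where

open import Data.Nat using (ℕ; zero; suc; _+_; _≤_)
open import Data.Bool using (Bool; true; false; if_then_else_)
open import Data.Fin using (Fin; zero; suc; toℕ)
open import Data.Fin.Permutation using (Permutation′; _⟨$⟩ʳ_)
open import Data.Product using (Σ; ∃; _×_; _,_)
open import Relation.Binary.PropositionalEquality using (_≡_; _≢_)
open import Relation.Nullary using (¬_; Dec; does)
open import Data.Fin using (_≟_)
open import Data.Bool using (_∧_)

record Graph (n : ℕ) : Set where
  field
    adj    : Fin n → Fin n → Bool
    sym    : ∀ u v → adj u v ≡ adj v u
    irrefl : ∀ u → adj u u ≡ false
open Graph public

Edge : ∀ {n} → Graph n → Fin n → Fin n → Set
Edge G u v = adj G u v ≡ true

countF : ∀ {n} → (Fin n → Bool) → ℕ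
countF {zero}  f = 0
countF {suc n} f = (if f zero then 1 else 0) + countF (λ i → f (suc i))

deg : ∀ {n} → Graph n → Fin n → ℕ
deg G u = countF (adj G u)

IsMaxDegree : ∀ {n} → Graph n → ℕ → Set
IsMaxDegree {n} G D = (∀ u → deg G u ≤ D) × (Σ (Fin n) λ u → deg G u ≡ D)

-- Outerplanarity: the vertices can be placed in some cyclic order on a
-- circle (position π v) such that no two edges, drawn as chords, cross.
-- Edges ab and cd cross iff  π a < π c < π b < π d  (edges are symmetric,
-- so this covers all interleavings).
Outerplanar : ∀ {n} → Graph n → Set
Outerplanar {n} G =
  Σ (Permutation′ n) λ π →
    ∀ a b c d → Edge G a b → Edge G c d →
      ¬ ( (suc (toℕ (π ⟨$⟩ʳ a)) ≤ toℕ (π ⟨$⟩ʳ c))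
        × (suc (toℕ (π ⟨$⟩ʳ c)) ≤ toℕ (π ⟨$⟩ʳ b))
        × (suc (toℕ (π ⟨$⟩ʳ b)) ≤ toℕ (π ⟨$⟩ʳ d)) )

-- An incidence colouring assigns to the incidence (u, uv) the colour φ u v
-- (values of φ on non-edges are irrelevant). Colours are Fin k ≅ [k].
-- d-defective incidence k-colouring:
IsDefIncColoring : ∀ {n} → Graph n → ℕ → (k : ℕ) → (Fin n → Fin n → Fin k) → Set
IsDefIncColoring {n} G d k φ =
  (∀ u v w → Edge G u v → Edge G u w → v ≢ w → φ u v ≢ φ u w)
  × (∀ u v → Edge G u v → φ u v ≢ φ v u)
  × (∀ u v → Edge G u v →
       countF (λ w → adj G u w ∧ does (φ w u ≟ φ u v)) ≤ d)

HasDefIncColoring : ∀ {n} → Graph n → ℕ → ℕ → Set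
HasDefIncColoring {n} G d k = Σ (Fin n → Fin n → Fin k) λ φ → IsDefIncColoring G d k φ

DefIncChromatic : ∀ {n} → Graph n → ℕ → ℕ → Set
DefIncChromatic G d m = HasDefIncColoring G d m × (∀ k → HasDefIncColoring G d k → m ≤ k)

{-# OPTIONS --safe #-}
module Submission where

-- Call an incidence colouring with colours Fin k ≅ ℤ/k cyclic if the strong incidences at each
-- vertex get distinct colours and the two incidences of every edge get consecutive colours.
-- A weak incidence of colour c at u then comes from a strong incidence of colour c − 1 or c + 1
-- at u, each used at most once, so a cyclic colouring is 2-defective; and condition (a) alone
-- already needs Δ colours at a vertex of maximum degree.
--
-- A cyclic Δ-colouring is built by deleting an edge vx and colouring it back in: (x, xv) gets a
-- colour a missing at x and (v, vx) a colour a ± 1 missing at v. For Δ ≥ 3 this works whenever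
-- deg v ≤ 2, and an outerplanar graph with an edge has such a non-isolated v (descend into ever
-- shorter chords). For Δ = 2 there are only two colours: delete an edge at a leaf if there is
-- one; otherwise all degrees are 0 or 2, and after deleting an edge of a cycle a handshake count
-- shows that the two ends of the resulting path received different colours, which is exactly
-- what closing the cycle again requires.

open import Defs hiding (sym)
open import Data.Bool using (Bool; true; false; if_then_else_; _∧_; _∨_; not)
  renaming (_≟_ to _≟ᵇ_)
open import Data.Bool.Properties using (∧-comm; ∧-identityʳ; ∨-zeroʳ; not-involutive)
open import Data.Empty using (⊥-elim)
open import Data.Fin using (Fin; zero; suc; toℕ; _≟_; fromℕ; inject₁; lower₁)
open import Data.Fin.Permutation using (_⟨$⟩ʳ_; _⟨$⟩ˡ_; inverseˡ)
import Data.Fin.Properties as Finₚ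
open import Data.Fin.Properties
  using (any?; toℕ-injective; toℕ-fromℕ; toℕ-lower₁; inject₁-lower₁;
         lower₁-inject₁′; toℕ-inject₁-≢)
open import Data.Nat using (ℕ; zero; suc; _+_; _≤_; _<_; z≤n; s≤s; s≤s⁻¹; _≤?_; _<?_)
  renaming (_≟_ to _≟ℕ_)
open import Data.Nat.Properties hiding (_≟_)
open import Algebra.Properties.CommutativeMonoid.Sum +-0-commutativeMonoid
  using (sum; sum-syntax; sum-cong-≗; ∑-comm; ∑-distrib-+)
open import Data.Product using (Σ; ∃; ∃₂; _×_; _,_; proj₁; proj₂)
open import Data.Sum using (_⊎_; inj₁; inj₂; swap)
import Data.Sum as Sum
open import Function using (_∘_; mk⇔)
open import Relation.Binary using (tri<; tri≈; tri>)
open import Relation.Binary.PropositionalEquality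
open import Relation.Nullary using (¬_; Dec; yes; no; does; contradiction)
open import Relation.Nullary.Decidable using (dec-true; dec-false; does-⇔)

does⇒ : ∀ {A : Set} (a? : Dec A) → does a? ≡ true → A
does⇒ (yes a) _ = a

∧-elim : ∀ {a b} → a ∧ b ≡ true → a ≡ true × b ≡ true
∧-elim {true} {true} _ = refl , refl

∧-intro : ∀ {a b} → a ≡ true → b ≡ true → a ∧ b ≡ true
∧-intro refl refl = refl

∨-introˡ : ∀ {a b} → a ≡ true → a ∨ b ≡ true
∨-introˡ refl = refl

∨-introʳ : ∀ {a b} → b ≡ true → a ∨ b ≡ true
∨-introʳ {a} refl = ∨-zeroʳ a

-- Counting

ind : Bool → ℕ
ind b = if b then 1 else 0

ind-mono : ∀ {a b} → (a ≡ true → b ≡ true) → ind a ≤ ind b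
ind-mono {false} _   = z≤n
ind-mono {true}  a⇒b rewrite a⇒b refl = ≤-refl

ind-∨ : ∀ a b → ind (a ∨ b) ≤ ind a + ind b
ind-∨ true  _ = s≤s z≤n
ind-∨ false _ = ≤-refl

ind-split : ∀ a b → ind a ≡ ind (a ∧ b) + ind (a ∧ not b)
ind-split false _     = refl
ind-split true  true  = refl
ind-split true  false = refl

sum-mono-≤ : ∀ {n} {f g : Fin n → ℕ} → (∀ i → f i ≤ g i) → sum f ≤ sum g
sum-mono-≤ {zero}  _   = z≤n
sum-mono-≤ {suc n} f≤g = +-mono-≤ (f≤g zero) (sum-mono-≤ (f≤g ∘ suc))

sum-mono-< : ∀ {n} {f g : Fin n → ℕ} → (∀ i → f i ≤ g i) → ∀ i → f i < g i → sum f < sum g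
sum-mono-< f≤g zero    f<g = +-mono-<-≤ f<g (sum-mono-≤ (f≤g ∘ suc))
sum-mono-< f≤g (suc i) f<g = +-mono-≤-< (f≤g zero) (sum-mono-< (f≤g ∘ suc) i f<g)

sum-ones : ∀ n → ∑[ i < n ] 1 ≡ n
sum-ones zero    = refl
sum-ones (suc n) = cong suc (sum-ones n)

sum≤n : ∀ {n} {f : Fin n → ℕ} → (∀ i → f i ≤ 1) → sum f ≤ n
sum≤n {n} {f} f≤1 = subst (sum f ≤_) (sum-ones n) (sum-mono-≤ f≤1)

sum<n⇒zero : ∀ {n} (f : Fin n → ℕ) → sum f < n → ∃ λ i → f i ≡ 0
sum<n⇒zero {n} f sum<n with any? (λ i → f i ≟ℕ 0)
... | yes found = found
... | no  none  = contradiction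
  (subst (_≤ sum f) (sum-ones n) (sum-mono-≤ (λ i → n≢0⇒n>0 (none ∘ (i ,_)))))
  (<⇒≱ sum<n)

countF-sum : ∀ {n} (f : Fin n → Bool) → countF f ≡ sum (ind ∘ f)
countF-sum {zero}  f = refl
countF-sum {suc n} f = cong (ind (f zero) +_) (countF-sum (f ∘ suc))

countF-false : ∀ n → countF {n} (λ _ → false) ≡ 0
countF-false zero    = refl
countF-false (suc n) = countF-false n

countF-cong : ∀ {n} {f g : Fin n → Bool} → (∀ i → f i ≡ g i) → countF f ≡ countF g
countF-cong {f = f} {g} f≗g = begin
  countF f       ≡⟨ countF-sum f ⟩
  sum (ind ∘ f)  ≡⟨ sum-cong-≗ (cong ind ∘ f≗g) ⟩
  sum (ind ∘ g)  ≡⟨ countF-sum g ⟨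
  countF g       ∎
  where open ≡-Reasoning

countF-mono : ∀ {n} {f g : Fin n → Bool} → (∀ i → f i ≡ true → g i ≡ true) → countF f ≤ countF g
countF-mono {f = f} {g} f⇒g = begin
  countF f       ≡⟨ countF-sum f ⟩
  sum (ind ∘ f)  ≤⟨ sum-mono-≤ (ind-mono ∘ f⇒g) ⟩
  sum (ind ∘ g)  ≡⟨ countF-sum g ⟨
  countF g       ∎
  where open ≤-Reasoning

countF-∨ : ∀ {n} (f g : Fin n → Bool) → countF (λ i → f i ∨ g i) ≤ countF f + countF g
countF-∨ f g = begin
  countF (λ i → f i ∨ g i)                ≡⟨ countF-sum (λ i → f i ∨ g i) ⟩
  sum (λ i → ind (f i ∨ g i))             ≤⟨ sum-mono-≤ (λ i → ind-∨ (f i) (g i)) ⟩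
  sum (λ i → ind (f i) + ind (g i))       ≡⟨ ∑-distrib-+ (ind ∘ f) (ind ∘ g) ⟩
  sum (ind ∘ f) + sum (ind ∘ g)           ≡⟨ cong₂ _+_ (countF-sum f) (countF-sum g) ⟨
  countF f + countF g                     ∎
  where open ≤-Reasoning

countF-split : ∀ {n} (f g : Fin n → Bool) →
               countF f ≡ countF (λ i → f i ∧ g i) + countF (λ i → f i ∧ not (g i))
countF-split {n} f g = begin
  countF f                                ≡⟨ countF-sum f ⟩
  sum (ind ∘ f)                           ≡⟨ sum-cong-≗ (λ i → ind-split (f i) (g i)) ⟩
  sum (λ i → ind (f∧g i) + ind (f∧¬g i))  ≡⟨ ∑-distrib-+ (ind ∘ f∧g) (ind ∘ f∧¬g) ⟩
  sum (ind ∘ f∧g) + sum (ind ∘ f∧¬g)      ≡⟨ cong₂ _+_ (countF-sum f∧g) (countF-sum f∧¬g) ⟨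
  countF f∧g + countF f∧¬g                ∎
  where
  open ≡-Reasoning
  f∧g f∧¬g : Fin n → Bool
  f∧g  i = f i ∧ g i
  f∧¬g i = f i ∧ not (g i)

countF-comm : ∀ {m n} (R : Fin m → Fin n → Bool) →
              ∑[ i < m ] countF (R i) ≡ ∑[ j < n ] countF (λ i → R i j)
countF-comm {m} {n} R = begin
  ∑[ i < m ] countF (R i)              ≡⟨ sum-cong-≗ (λ i → countF-sum (R i)) ⟩
  ∑[ i < m ] ∑[ j < n ] ind (R i j)    ≡⟨ ∑-comm (λ i j → ind (R i j)) ⟩
  ∑[ j < n ] ∑[ i < m ] ind (R i j)    ≡⟨ sum-cong-≗ (λ j → countF-sum (λ i → R i j)) ⟨
  ∑[ j < n ] countF (λ i → R i j)      ∎
  where open ≡-Reasoning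

countF≥1 : ∀ {n} {f : Fin n → Bool} i → f i ≡ true → 1 ≤ countF f
countF≥1         zero    f₀ rewrite f₀ = s≤s z≤n
countF≥1 {f = f} (suc i) fᵢ = ≤-trans (countF≥1 {f = f ∘ suc} i fᵢ) (m≤n+m _ _)

countF≥2 : ∀ {n} {f : Fin n → Bool} {i j} → f i ≡ true → f j ≡ true → i ≢ j → 2 ≤ countF f
countF≥2 {f = f} {i} {j} fᵢ fⱼ i≢j =
  subst (2 ≤_) (sym (countF-split f (λ k → does (k ≟ i))))
    (+-mono-≤ (countF≥1 i (∧-intro fᵢ (dec-true (i ≟ i) refl)))
              (countF≥1 j (∧-intro fⱼ (cong not (dec-false (j ≟ i) (i≢j ∘ sym))))))

countF≥1⇒∃ : ∀ {n} (f : Fin n → Bool) → 1 ≤ countF f → ∃ λ i → f i ≡ true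
countF≥1⇒∃ {suc n} f 1≤c with f zero in f₀
... | true  = zero , f₀
... | false = let i , fᵢ = countF≥1⇒∃ (f ∘ suc) 1≤c in suc i , fᵢ

countF≥2⇒∃₂ : ∀ {n} (f : Fin n → Bool) → 2 ≤ countF f →
              ∃₂ λ i j → i ≢ j × f i ≡ true × f j ≡ true
countF≥2⇒∃₂ {suc n} f 2≤c with f zero in f₀
... | true  = let j , fⱼ = countF≥1⇒∃ (f ∘ suc) (s≤s⁻¹ 2≤c) in zero , suc j , (λ ()) , f₀ , fⱼ
... | false = let i , j , i≢j , fᵢ , fⱼ = countF≥2⇒∃₂ (f ∘ suc) 2≤c
              in suc i , suc j , i≢j ∘ Finₚ.suc-injective , fᵢ , fⱼ

countF≤1 : ∀ {n} {f : Fin n → Bool} → (∀ {i j} → f i ≡ true → f j ≡ true → i ≡ j) → countF f ≤ 1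
countF≤1 {f = f} unique with countF f ≤? 1
... | yes c≤1 = c≤1
... | no  c≰1 = let _ , _ , i≢j , fᵢ , fⱼ = countF≥2⇒∃₂ f (≰⇒> c≰1) in contradiction (unique fᵢ fⱼ) i≢j

countF≤1⇒unique : ∀ {n} {f : Fin n → Bool} → countF f ≤ 1 → ∀ {i j} → f i ≡ true → f j ≡ true → i ≡ j
countF≤1⇒unique c≤1 {i} {j} fᵢ fⱼ with i ≟ j
... | yes i≡j = i≡j
... | no  i≢j = contradiction (countF≥2 fᵢ fⱼ i≢j) (<⇒≱ (s≤s c≤1))

InjectiveOn : ∀ {n} {A : Set} → (Fin n → Bool) → (Fin n → A) → Set
InjectiveOn P f = ∀ {i j} → P i ≡ true → P j ≡ true → f i ≡ f j → i ≡ j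

module _ {n k : ℕ} (P : Fin n → Bool) (f : Fin n → Fin k) where

  Fibre : Fin k → Fin n → Bool
  Fibre c i = P i ∧ does (f i ≟ c)

  countF-fibres : countF P ≡ ∑[ c < k ] countF (Fibre c)
  countF-fibres = trans (countF-sum P) (trans (sum-cong-≗ fibres-over) (countF-comm (λ i c → Fibre c i)))
    where
    fibres-over : ∀ i → ind (P i) ≡ countF (λ c → Fibre c i)
    fibres-over i with P i
    ... | false = sym (countF-false k)
    ... | true  = ≤-antisym
      (countF≥1 (f i) (dec-true (f i ≟ f i) refl))
      (countF≤1 (λ e₁ e₂ → trans (sym (does⇒ (f i ≟ _) e₁)) (does⇒ (f i ≟ _) e₂)))

  fibre≤1 : InjectiveOn P f → ∀ c → countF (Fibre c) ≤ 1
  fibre≤1 injective c = countF≤1 λ {i} {j} e₁ e₂ →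
    let Pᵢ , fᵢ≡c = ∧-elim e₁
        Pⱼ , fⱼ≡c = ∧-elim e₂
    in injective Pᵢ Pⱼ (trans (does⇒ (f i ≟ c) fᵢ≡c) (sym (does⇒ (f j ≟ c) fⱼ≡c)))

  pigeonhole : InjectiveOn P f → countF P ≤ k
  pigeonhole injective = subst (_≤ k) (sym countF-fibres) (sum≤n (fibre≤1 injective))

  missing-value : countF P < k → ∃ λ c → ∀ i → P i ≡ true → f i ≢ c
  missing-value P<k with sum<n⇒zero _ (subst (_< k) countF-fibres P<k)
  ... | c , empty = c , λ i Pᵢ fᵢ≡c →
    contradiction (subst (1 ≤_) empty (countF≥1 i (∧-intro Pᵢ (dec-true (f i ≟ c) fᵢ≡c)))) λ ()

-- Cyclic colours

csuc : ∀ {m} → Fin (suc m) → Fin (suc m)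
csuc {m} i with m ≟ℕ toℕ i
... | yes _   = zero
... | no  m≢i = suc (lower₁ i m≢i)

cpred : ∀ {m} → Fin (suc m) → Fin (suc m)
cpred zero    = fromℕ _
cpred (suc j) = inject₁ j

toℕ-csuc : ∀ {m} (i : Fin (suc m)) → (m ≡ toℕ i × csuc i ≡ zero) ⊎ toℕ (csuc i) ≡ suc (toℕ i)
toℕ-csuc {m} i with m ≟ℕ toℕ i
... | yes m≡i = inj₁ (m≡i , refl)
... | no  m≢i = inj₂ (cong suc (toℕ-lower₁ i m≢i))

cpred-csuc : ∀ {m} (i : Fin (suc m)) → cpred (csuc i) ≡ i
cpred-csuc {m} i with m ≟ℕ toℕ i
... | yes m≡i = toℕ-injective (trans (toℕ-fromℕ m) m≡i)
... | no  m≢i = inject₁-lower₁ i m≢i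

csuc-cpred : ∀ {m} (i : Fin (suc m)) → csuc (cpred i) ≡ i
csuc-cpred {m} zero with m ≟ℕ toℕ (fromℕ m)
... | yes _   = refl
... | no  m≢m = contradiction (sym (toℕ-fromℕ m)) m≢m
csuc-cpred {m} (suc j) with m ≟ℕ toℕ (inject₁ j)
... | yes m≡j = contradiction m≡j (toℕ-inject₁-≢ j)
... | no  m≢j = cong suc (lower₁-inject₁′ j m≢j)

csuc-injective : ∀ {m} {i j : Fin (suc m)} → csuc i ≡ csuc j → i ≡ j
csuc-injective {i = i} {j} e = trans (sym (cpred-csuc i)) (trans (cong cpred e) (cpred-csuc j))

csuc-fixfree : ∀ {m} → 1 ≤ m → (i : Fin (suc m)) → csuc i ≢ i
csuc-fixfree 1≤m i e with toℕ-csuc i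
... | inj₁ (m≡i , i⁺≡0) = contradiction (trans m≡i (cong toℕ (trans (sym e) i⁺≡0))) (>⇒≢ 1≤m)
... | inj₂ i⁺≡1+i        = 1+n≢n (trans (sym i⁺≡1+i) (cong toℕ e))

csuc²-fixfree : ∀ {m} → 2 ≤ m → (i : Fin (suc m)) → csuc (csuc i) ≢ i
csuc²-fixfree {m} 2≤m i e with toℕ-csuc i | toℕ-csuc (csuc i)
... | inj₁ (m≡i , i⁺≡0) | _ with toℕ-csuc {m} zero
...   | inj₁ (m≡0 , _) = contradiction m≡0 (>⇒≢ (≤-trans (s≤s z≤n) 2≤m))
...   | inj₂ 0⁺≡1      = contradiction
          (trans m≡i (trans (cong toℕ (sym e)) (trans (cong (toℕ ∘ csuc) i⁺≡0) 0⁺≡1))) (>⇒≢ 2≤m)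
csuc²-fixfree 2≤m i e | inj₂ i⁺≡1+i | inj₁ (m≡i⁺ , i⁺⁺≡0) =
  contradiction (trans m≡i⁺ (trans i⁺≡1+i (cong (suc ∘ toℕ) (trans (sym e) i⁺⁺≡0)))) (>⇒≢ 2≤m)
csuc²-fixfree 2≤m i e | inj₂ i⁺≡1+i | inj₂ i⁺⁺≡1+i⁺ =
  m≢1+m+n (toℕ i) (trans (cong toℕ (sym e))
    (trans i⁺⁺≡1+i⁺ (cong suc (trans i⁺≡1+i (+-comm 1 (toℕ i))))))

csuc≢cpred : ∀ {m} → 2 ≤ m → (i : Fin (suc m)) → csuc i ≢ cpred i
csuc≢cpred 2≤m i e = csuc²-fixfree 2≤m i (trans (cong csuc e) (csuc-cpred i))

Consecutive : ∀ {m} → Fin (suc m) → Fin (suc m) → Set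
Consecutive i j = j ≡ csuc i ⊎ i ≡ csuc j

consecutive⇒≢ : ∀ {m} → 1 ≤ m → {i j : Fin (suc m)} → Consecutive i j → i ≢ j
consecutive⇒≢ 1≤m {i} (inj₁ j≡i⁺) i≡j = csuc-fixfree 1≤m i (trans (sym j≡i⁺) (sym i≡j))
consecutive⇒≢ 1≤m {j = j} (inj₂ i≡j⁺) i≡j = csuc-fixfree 1≤m j (trans (sym i≡j⁺) i≡j)

consecutive₂ : {i j : Fin 2} → Consecutive i j → j ≡ csuc i
consecutive₂                (inj₁ j≡i⁺) = j≡i⁺
consecutive₂ {j = zero}     (inj₂ refl) = refl
consecutive₂ {j = suc zero} (inj₂ refl) = refl

≟-csuc : ∀ {m} (i j : Fin (suc m)) → does (i ≟ j) ≡ does (csuc i ≟ csuc j)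
≟-csuc i j = does-⇔ (mk⇔ (cong csuc) csuc-injective) (i ≟ j) (csuc i ≟ csuc j)

≢-csuc₂ : (i j : Fin 2) → not (does (i ≟ j)) ≡ does (i ≟ csuc j)
≢-csuc₂ zero       zero       = refl
≢-csuc₂ zero       (suc zero) = refl
≢-csuc₂ (suc zero) zero       = refl
≢-csuc₂ (suc zero) (suc zero) = refl

-- Incidence colourings

Proper : ∀ {n k} → Graph n → (Fin n → Fin n → Fin k) → Set
Proper H φ = ∀ u v w → Edge H u v → Edge H u w → v ≢ w → φ u v ≢ φ u w

IsCyclicIncColoring : ∀ {n m} → Graph n → (Fin n → Fin n → Fin (suc m)) → Set
IsCyclicIncColoring H φ = Proper H φ × (∀ u v → Edge H u v → Consecutive (φ u v) (φ v u))

HasCyclicIncColoring : ∀ {n} → Graph n → ℕ → Set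
HasCyclicIncColoring {n} H m = Σ (Fin n → Fin n → Fin (suc m)) (IsCyclicIncColoring H)

Avoids : ∀ {n k} → Graph n → (Fin n → Fin n → Fin k) → Fin n → Fin k → Set
Avoids H φ u c = ∀ w → Edge H u w → φ u w ≢ c

module _ {n : ℕ} (H : Graph n) where

  edge-sym : ∀ {u w} → Edge H u w → Edge H w u
  edge-sym {u} {w} uw = trans (Graph.sym H w u) uw

  edge-irrefl : ∀ {u w} → Edge H u w → u ≢ w
  edge-irrefl {u} uw refl = contradiction (trans (sym uw) (irrefl H u)) λ ()

  edge? : Dec (∃₂ λ u w → Edge H u w)
  edge? = any? λ u → any? λ w → adj H u w ≟ᵇ true

  edgeless-coloring : ∀ {m} → ¬ (∃₂ λ u w → Edge H u w) → HasCyclicIncColoring H m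
  edgeless-coloring none =
    (λ _ _ → zero) , (λ u v _ uv _ _ _ → none (u , v , uv)) , λ u v uv → ⊥-elim (none (u , v , uv))

  module _ {k : ℕ} {φ : Fin n → Fin n → Fin k} where

    proper⇒injectiveOn : Proper H φ → ∀ u → InjectiveOn (adj H u) (φ u)
    proper⇒injectiveOn proper u {i} {j} uᵢ uⱼ φᵢ≡φⱼ with i ≟ j
    ... | yes i≡j = i≡j
    ... | no  i≢j = contradiction φᵢ≡φⱼ (proper u i j uᵢ uⱼ i≢j)

    deg≤colors : Proper H φ → ∀ u → deg H u ≤ k
    deg≤colors proper u = pigeonhole (adj H u) (φ u) (proper⇒injectiveOn proper u)

    free-color : ∀ {u} → deg H u < k → ∃ (Avoids H φ u)
    free-color {u} = missing-value (adj H u) (φ u)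

    isolated-avoids : ∀ {u c} → deg H u ≡ 0 → Avoids H φ u c
    isolated-avoids d≡0 w uw _ = contradiction (subst (1 ≤_) d≡0 (countF≥1 w uw)) λ ()

    avoids-beside : ∀ {u t c} → deg H u ≤ 1 → Edge H u t → φ u t ≢ c → Avoids H φ u c
    avoids-beside {u} {c = c} d≤1 ut φₜ≢c w uw =
      subst (λ t → φ u t ≢ c) (countF≤1⇒unique d≤1 ut uw) φₜ≢c

    one-of-two-avoided : ∀ {u c₁ c₂} → deg H u ≤ 1 → c₁ ≢ c₂ → Avoids H φ u c₁ ⊎ Avoids H φ u c₂
    one-of-two-avoided {u} {c₁} d≤1 c₁≢c₂ with any? (λ t → adj H u t ≟ᵇ true)
    ... | no  isolated = inj₁ λ w uw _ → isolated (w , uw)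
    ... | yes (t , ut) with φ u t ≟ c₁
    ...   | yes φₜ≡c₁ = inj₂ (avoids-beside d≤1 ut λ φₜ≡c₂ → c₁≢c₂ (trans (sym φₜ≡c₁) φₜ≡c₂))
    ...   | no  φₜ≢c₁ = inj₁ (avoids-beside d≤1 ut φₜ≢c₁)

  cyclic⇒defective : ∀ {m d} {φ : Fin n → Fin n → Fin (suc m)} → 1 ≤ m → 2 ≤ d →
                     IsCyclicIncColoring H φ → IsDefIncColoring H d (suc m) φ
  cyclic⇒defective {d = d} {φ} 1≤m 2≤d (proper , consecutive) =
    proper , (λ u v uv → consecutive⇒≢ 1≤m (consecutive u v uv)) , defect
    where
    defect : ∀ u v → Edge H u v → countF (λ w → adj H u w ∧ does (φ w u ≟ φ u v)) ≤ d
    defect u v _ = begin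
      countF (λ w → adj H u w ∧ does (φ w u ≟ c))  ≤⟨ countF-mono weak⇒strong ⟩
      countF (λ w → below w ∨ above w)             ≤⟨ countF-∨ below above ⟩
      countF below + countF above                  ≤⟨ +-mono-≤ (fibre≤1 _ _ csuc-injectiveOn c)
                                                               (fibre≤1 _ _ injectiveOn (csuc c)) ⟩
      2                                            ≤⟨ 2≤d ⟩
      d                                            ∎
      where
      open ≤-Reasoning
      c = φ u v
      below above : Fin n → Bool
      below = Fibre (adj H u) (csuc ∘ φ u) c
      above = Fibre (adj H u) (φ u) (csuc c)
      injectiveOn = proper⇒injectiveOn proper u
      csuc-injectiveOn : InjectiveOn (adj H u) (csuc ∘ φ u)
      csuc-injectiveOn uᵢ uⱼ = injectiveOn uᵢ uⱼ ∘ csuc-injective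
      weak⇒strong : ∀ w → adj H u w ∧ does (φ w u ≟ c) ≡ true → below w ∨ above w ≡ true
      weak⇒strong w e with ∧-elim e
      ... | uw , φwu≟c with consecutive u w uw | does⇒ (φ w u ≟ c) φwu≟c
      ...   | inj₁ wu≡uw⁺ | wu≡c =
        ∨-introˡ (∧-intro uw (dec-true (_ ≟ c) (trans (sym wu≡uw⁺) wu≡c)))
      ...   | inj₂ uw≡wu⁺ | wu≡c =
        ∨-introʳ (∧-intro uw (dec-true (_ ≟ csuc c) (trans uw≡wu⁺ (cong csuc wu≡c))))

-- Deleting an edge

isEnd : ∀ {n} → Fin n → Fin n → Fin n → Bool
isEnd v x t = does (t ≟ v) ∨ does (t ≟ x)

-- Deletes every pair inside {v, x}; as H has no loops, that is just the edge vx.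
removeEdge : ∀ {n} → Graph n → Fin n → Fin n → Graph n
removeEdge H v x = record
  { adj    = λ u w → adj H u w ∧ not (isEnd v x u ∧ isEnd v x w)
  ; sym    = λ u w → cong₂ (λ e f → e ∧ not f) (Graph.sym H u w) (∧-comm (isEnd v x u) (isEnd v x w))
  ; irrefl = λ u → cong (λ e → e ∧ not (isEnd v x u ∧ isEnd v x u)) (irrefl H u)
  }

degreeSum : ∀ {n} → Graph n → ℕ
degreeSum {n} H = ∑[ u < n ] deg H u

module _ {n : ℕ} (v x : Fin n) where

  isEnd-sound : ∀ {t} → isEnd v x t ≡ true → t ≡ v ⊎ t ≡ x
  isEnd-sound {t} e with t ≟ v | t ≟ x
  ... | yes t≡v | _       = inj₁ t≡v
  ... | no  _   | yes t≡x = inj₂ t≡x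

  isEnd-left : isEnd v x v ≡ true
  isEnd-left = cong (_∨ does (v ≟ x)) (dec-true (v ≟ v) refl)

  isEnd-right : isEnd v x x ≡ true
  isEnd-right = trans (cong (does (x ≟ v) ∨_) (dec-true (x ≟ x) refl)) (∨-zeroʳ _)

  ends-unique : ∀ {u w₁ w₂} → isEnd v x u ≡ true → isEnd v x w₁ ≡ true → isEnd v x w₂ ≡ true →
                u ≢ w₁ → u ≢ w₂ → w₁ ≡ w₂
  ends-unique {u} {w₁} {w₂} u∈ w₁∈ w₂∈ u≢w₁ u≢w₂
    with isEnd-sound {u} u∈ | isEnd-sound {w₁} w₁∈ | isEnd-sound {w₂} w₂∈
  ... | _         | inj₁ refl | inj₁ refl = refl
  ... | _         | inj₂ refl | inj₂ refl = refl
  ... | inj₁ refl | inj₁ refl | _         = contradiction refl u≢w₁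
  ... | inj₂ refl | inj₂ refl | _         = contradiction refl u≢w₁
  ... | inj₁ refl | _         | inj₁ refl = contradiction refl u≢w₂
  ... | inj₂ refl | _         | inj₂ refl = contradiction refl u≢w₂

module _ {n : ℕ} (H : Graph n) {v x : Fin n} where

  private
    H⁻ = removeEdge H v x

  removeEdge-⊆ : ∀ {u w} → Edge H⁻ u w → Edge H u w
  removeEdge-⊆ = proj₁ ∘ ∧-elim

  kept⇒not-ends : ∀ {u w} → Edge H⁻ u w → isEnd v x u ∧ isEnd v x w ≡ false
  kept⇒not-ends {u} {w} uw = trans (sym (not-involutive _)) (cong not (proj₂ (∧-elim uw)))

  kept-or-ends : ∀ {u w} → Edge H u w → Edge H⁻ u w ⊎ (isEnd v x u ≡ true × isEnd v x w ≡ true)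
  kept-or-ends {u} {w} uw = Sum.map₂ ∧-elim (keep (isEnd v x u ∧ isEnd v x w))
    where
    keep : ∀ b → adj H u w ∧ not b ≡ true ⊎ b ≡ true
    keep false = inj₁ (∧-intro uw refl)
    keep true  = inj₂ refl

  deg-removeEdge-≤ : ∀ u → deg H⁻ u ≤ deg H u
  deg-removeEdge-≤ u = countF-mono {f = adj H⁻ u} {g = adj H u} λ _ → removeEdge-⊆

  removeEdge-maxDegree : ∀ {D} → (∀ u → deg H u ≤ D) → ∀ u → deg H⁻ u ≤ D
  removeEdge-maxDegree Δ u = ≤-trans (deg-removeEdge-≤ u) (Δ u)

  deg-removeEdge-inner : ∀ {u} → isEnd v x u ≡ false → deg H⁻ u ≡ deg H u
  deg-removeEdge-inner {u} u∉ = countF-cong λ w →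
    trans (cong (λ e → adj H u w ∧ not (e ∧ isEnd v x w)) u∉) (∧-identityʳ _)

  module _ (vx : Edge H v x) where

    other-end : ∀ {u} → isEnd v x u ≡ true → ∃ λ t → Edge H u t × isEnd v x t ≡ true
    other-end {u} u∈ with isEnd-sound v x {u} u∈
    ... | inj₁ refl = x , vx , isEnd-right v x
    ... | inj₂ refl = v , edge-sym H vx , isEnd-left v x

    deg-removeEdge-end : ∀ {u} → isEnd v x u ≡ true → deg H u ≡ suc (deg H⁻ u)
    deg-removeEdge-end {u} u∈ = begin
      deg H u                                                  ≡⟨ countF-split (adj H u) (isEnd v x) ⟩
      countF (λ w → adj H u w ∧ isEnd v x w) +
        countF (λ w → adj H u w ∧ not (isEnd v x w))           ≡⟨ cong₂ _+_ one-end rest ⟩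
      1 + deg H⁻ u                                             ∎
      where
      open ≡-Reasoning
      one-end : countF (λ w → adj H u w ∧ isEnd v x w) ≡ 1
      one-end = let t , ut , t∈ = other-end u∈ in ≤-antisym
        (countF≤1 λ e₁ e₂ → let uw₁ , w₁∈ = ∧-elim e₁; uw₂ , w₂∈ = ∧-elim e₂ in
          ends-unique v x u∈ w₁∈ w₂∈ (edge-irrefl H uw₁) (edge-irrefl H uw₂))
        (countF≥1 t (∧-intro ut t∈))
      rest : countF (λ w → adj H u w ∧ not (isEnd v x w)) ≡ deg H⁻ u
      rest = countF-cong λ w → cong (λ e → adj H u w ∧ not (e ∧ isEnd v x w)) (sym u∈)

    deg-removeEdge-end-< : ∀ {u D} → isEnd v x u ≡ true → deg H u ≤ D → deg H⁻ u < D
    deg-removeEdge-end-< {D = D} u∈ = subst (_≤ D) (deg-removeEdge-end u∈)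

    degreeSum-removeEdge : degreeSum H⁻ < degreeSum H
    degreeSum-removeEdge =
      sum-mono-< deg-removeEdge-≤ v (≤-reflexive (sym (deg-removeEdge-end (isEnd-left v x))))

removeEdge-induction : ∀ {n} (P : Graph n → Set) →
                       (∀ H → (∀ {v x} → Edge H v x → P (removeEdge H v x)) → P H) → ∀ H → P H
removeEdge-induction P step H = go (suc (degreeSum H)) H ≤-refl
  where
  go : ∀ s H → degreeSum H < s → P H
  go zero    H ()
  go (suc s) H <s = step H λ vx → go s _ (≤-trans (degreeSum-removeEdge H vx) (s≤s⁻¹ <s))

module AddEdge {n m} (H : Graph n) {v x : Fin n} (vx : Edge H v x)
  {φ⁻ : Fin n → Fin n → Fin (suc m)} (φ⁻-cyclic : IsCyclicIncColoring (removeEdge H v x) φ⁻)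
  {a b : Fin (suc m)} (a∼b : Consecutive a b)
  (a-free : Avoids (removeEdge H v x) φ⁻ x a) (b-free : Avoids (removeEdge H v x) φ⁻ v b) where

  private
    H⁻ = removeEdge H v x

  v≢x : v ≢ x
  v≢x = edge-irrefl H vx

  newColor : Fin n → Fin (suc m)
  newColor u = if does (u ≟ x) then a else b

  newColor-x : newColor x ≡ a
  newColor-x = cong (if_then a else b) (dec-true (x ≟ x) refl)

  newColor-v : newColor v ≡ b
  newColor-v = cong (if_then a else b) (dec-false (v ≟ x) v≢x)

  φ : Fin n → Fin n → Fin (suc m)
  φ u w = if isEnd v x u ∧ isEnd v x w then newColor u else φ⁻ u w

  φ-kept : ∀ u w → Edge H⁻ u w → φ u w ≡ φ⁻ u w
  φ-kept u w uw = cong (if_then newColor u else φ⁻ u w) (kept⇒not-ends H uw)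

  φ-new : ∀ u w → isEnd v x u ≡ true → isEnd v x w ≡ true → φ u w ≡ newColor u
  φ-new u w u∈ w∈ = cong (if_then newColor u else φ⁻ u w) (cong₂ _∧_ u∈ w∈)

  newColor-avoids : ∀ u → isEnd v x u ≡ true → Avoids H⁻ φ⁻ u (newColor u)
  newColor-avoids u u∈ with isEnd-sound v x {u} u∈
  ... | inj₁ refl = subst (Avoids H⁻ φ⁻ v) (sym newColor-v) b-free
  ... | inj₂ refl = subst (Avoids H⁻ φ⁻ x) (sym newColor-x) a-free

  newColor-consecutive : ∀ u w → isEnd v x u ≡ true → isEnd v x w ≡ true → u ≢ w →
                          Consecutive (newColor u) (newColor w)
  newColor-consecutive u w u∈ w∈ u≢w with isEnd-sound v x {u} u∈ | isEnd-sound v x {w} w∈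
  ... | inj₁ refl | inj₁ refl = contradiction refl u≢w
  ... | inj₂ refl | inj₂ refl = contradiction refl u≢w
  ... | inj₁ refl | inj₂ refl = subst₂ Consecutive (sym newColor-v) (sym newColor-x) (swap a∼b)
  ... | inj₂ refl | inj₁ refl = subst₂ Consecutive (sym newColor-x) (sym newColor-v) a∼b

  new≢kept : ∀ u w w′ → isEnd v x u ≡ true → isEnd v x w ≡ true → Edge H⁻ u w′ → φ u w ≢ φ u w′
  new≢kept u w w′ u∈ w∈ uw′ φw≡φw′ =
    newColor-avoids u u∈ w′ uw′ (trans (sym (φ-kept u w′ uw′)) (trans (sym φw≡φw′) (φ-new u w u∈ w∈)))

  proper : Proper H φ
  proper u w₁ w₂ uw₁ uw₂ w₁≢w₂ φ₁≡φ₂ with kept-or-ends H uw₁ | kept-or-ends H uw₂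
  ... | inj₂ (u∈ , w₁∈) | inj₂ (_ , w₂∈) =
    w₁≢w₂ (ends-unique v x u∈ w₁∈ w₂∈ (edge-irrefl H uw₁) (edge-irrefl H uw₂))
  ... | inj₂ (u∈ , w₁∈) | inj₁ uw₂⁻      = new≢kept u w₁ w₂ u∈ w₁∈ uw₂⁻ φ₁≡φ₂
  ... | inj₁ uw₁⁻      | inj₂ (u∈ , w₂∈) = new≢kept u w₂ w₁ u∈ w₂∈ uw₁⁻ (sym φ₁≡φ₂)
  ... | inj₁ uw₁⁻      | inj₁ uw₂⁻ =
    proj₁ φ⁻-cyclic u w₁ w₂ uw₁⁻ uw₂⁻ w₁≢w₂
      (trans (sym (φ-kept u w₁ uw₁⁻)) (trans φ₁≡φ₂ (φ-kept u w₂ uw₂⁻)))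

  consecutive : ∀ u w → Edge H u w → Consecutive (φ u w) (φ w u)
  consecutive u w uw with kept-or-ends H uw
  ... | inj₂ (u∈ , w∈) = subst₂ Consecutive (sym (φ-new u w u∈ w∈)) (sym (φ-new w u w∈ u∈))
                           (newColor-consecutive u w u∈ w∈ (edge-irrefl H uw))
  ... | inj₁ uw⁻ = subst₂ Consecutive (sym (φ-kept u w uw⁻)) (sym (φ-kept w u (edge-sym H⁻ uw⁻)))
                     (proj₂ φ⁻-cyclic u w uw⁻)

addEdge-cyclic : ∀ {n m} (H : Graph n) {v x : Fin n} → Edge H v x →
                 ∀ {φ⁻ : Fin n → Fin n → Fin (suc m)} → IsCyclicIncColoring (removeEdge H v x) φ⁻ →
                 ∀ {a b} → Consecutive a b →
                 Avoids (removeEdge H v x) φ⁻ x a → Avoids (removeEdge H v x) φ⁻ v b →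
                 HasCyclicIncColoring H m
addEdge-cyclic H vx φ⁻-cyclic a∼b a-free b-free = φ , proper , consecutive
  where open AddEdge H vx φ⁻-cyclic a∼b a-free b-free

-- Two colours

balanced-if-even : ∀ {a b} → a ≤ 1 → b ≤ 1 → a + b ≡ 0 ⊎ a + b ≡ 2 → a ≡ b + 0
balanced-if-even z≤n       z≤n       _         = refl
balanced-if-even (s≤s z≤n) (s≤s z≤n) _         = refl
balanced-if-even z≤n       (s≤s z≤n) (inj₁ ())
balanced-if-even z≤n       (s≤s z≤n) (inj₂ ())
balanced-if-even (s≤s z≤n) z≤n       (inj₁ ())
balanced-if-even (s≤s z≤n) z≤n       (inj₂ ())

surplus-if-odd : ∀ {a b} → a + b ≡ 1 → 1 ≤ a → a ≡ b + 1
surplus-if-odd {suc zero}    {zero}  _  _ = refl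
surplus-if-odd {suc zero}    {suc _} () _
surplus-if-odd {suc (suc _)}         () _

module PathEnds {n} (H : Graph n) {φ : Fin n → Fin n → Fin 2} (cyclic : IsCyclicIncColoring H φ) where

  class : Fin 2 → Fin n → ℕ
  class j u = countF (Fibre (adj H u) (φ u) j)

  -- Each edge carries exactly one incidence of each colour.
  balanced : ∀ j → ∑[ u < n ] class j u ≡ ∑[ u < n ] class (csuc j) u
  balanced j = trans (countF-comm (λ u w → Fibre (adj H u) (φ u) j w))
                     (sum-cong-≗ λ w → countF-cong (flip w))
    where
    flip : ∀ w u → Fibre (adj H u) (φ u) j w ≡ Fibre (adj H w) (φ w) (csuc j) u
    flip w u with adj H u w in uw
    ... | false = sym (cong (_∧ _) (trans (Graph.sym H w u) uw))
    ... | true  = begin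
      does (φ u w ≟ j)                   ≡⟨ ≟-csuc (φ u w) j ⟩
      does (csuc (φ u w) ≟ csuc j)       ≡⟨ cong (λ c → does (c ≟ csuc j)) wu≡uw⁺ ⟨
      does (φ w u ≟ csuc j)              ≡⟨ cong (_∧ does (φ w u ≟ csuc j)) (edge-sym H uw) ⟨
      adj H w u ∧ does (φ w u ≟ csuc j)  ∎
      where
      open ≡-Reasoning
      wu≡uw⁺ = consecutive₂ (proj₂ cyclic u w uw)

  class-split : ∀ j u → deg H u ≡ class j u + class (csuc j) u
  class-split j u = trans (countF-split (adj H u) (λ w → does (φ u w ≟ j)))
    (cong (class j u +_) (countF-cong λ w → cong (adj H u w ∧_) (≢-csuc₂ (φ u w) j)))

  class≤1 : ∀ j u → class j u ≤ 1
  class≤1 j u = fibre≤1 (adj H u) (φ u) (proper⇒injectiveOn H (proj₁ cyclic) u) j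

  class-even : ∀ {u} j → deg H u ≡ 0 ⊎ deg H u ≡ 2 → class j u ≡ class (csuc j) u + 0
  class-even {u} j even = balanced-if-even (class≤1 j u) (class≤1 (csuc j) u)
    (Sum.map (trans (sym (class-split j u))) (trans (sym (class-split j u))) even)

  class-end : ∀ {u t} → deg H u ≡ 1 → Edge H u t → class (φ u t) u ≡ class (csuc (φ u t)) u + 1
  class-end {u} {t} d≡1 ut = surplus-if-odd (trans (sym (class-split (φ u t) u)) d≡1)
    (countF≥1 t (∧-intro ut (dec-true (φ u t ≟ φ u t) refl)))

  -- If both ends had colour j, class j would exceed class (csuc j) by one at v and at x and
  -- equal it elsewhere, contradicting balanced.
  path-ends-differ : ∀ {v x y z} → (∀ u → isEnd v x u ≡ false → deg H u ≡ 0 ⊎ deg H u ≡ 2) →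
                     deg H v ≡ 1 → deg H x ≡ 1 → Edge H v y → Edge H x z → φ v y ≢ φ x z
  path-ends-differ {v} {x} {y} {z} even dv≡1 dx≡1 vy xz φvy≡φxz =
    <⇒≢ (m<m+n S (countF≥1 v (isEnd-left v x))) excess
    where
    j = φ v y
    surplus : ∀ u → class j u ≡ class (csuc j) u + ind (isEnd v x u)
    surplus u with isEnd v x u in u∈
    ... | false = class-even j (even u u∈)
    ... | true with isEnd-sound v x {u} u∈
    ...   | inj₁ refl = class-end dv≡1 vy
    ...   | inj₂ refl = subst (λ c → class c x ≡ class (csuc c) x + 1) (sym φvy≡φxz) (class-end dx≡1 xz)
    S = ∑[ u < n ] class (csuc j) u
    excess : S ≡ S + countF (isEnd v x)
    excess = begin
      S                                                  ≡⟨ balanced j ⟨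
      ∑[ u < n ] class j u                               ≡⟨ sum-cong-≗ surplus ⟩
      ∑[ u < n ] (class (csuc j) u + ind (isEnd v x u))  ≡⟨ ∑-distrib-+ (class (csuc j)) (ind ∘ isEnd v x) ⟩
      S + sum (ind ∘ isEnd v x)                          ≡⟨ cong (S +_) (countF-sum (isEnd v x)) ⟨
      S + countF (isEnd v x)                             ∎
      where open ≡-Reasoning

module _ {n : ℕ} (H : Graph n) {v x : Fin n} (vx : Edge H v x) where

  private
    H⁻ = removeEdge H v x

  extend-at-leaf : ∀ {m} → deg H v ≡ 1 → deg H x ≤ suc m →
                   HasCyclicIncColoring H⁻ m → HasCyclicIncColoring H m
  extend-at-leaf dv≡1 dx≤ (φ⁻ , cyclic⁻) =
    let a , a-free = free-color H⁻ {φ = φ⁻} (deg-removeEdge-end-< H vx (isEnd-right v x) dx≤)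
        v-isolated = suc-injective (trans (sym (deg-removeEdge-end H vx (isEnd-left v x))) dv≡1)
    in addEdge-cyclic H vx cyclic⁻ (inj₁ refl) a-free (isolated-avoids H⁻ {φ = φ⁻} v-isolated)

  extend-at-low-vertex : ∀ {m} → 2 ≤ m → deg H v ≤ 2 → deg H x ≤ suc m →
                         HasCyclicIncColoring H⁻ m → HasCyclicIncColoring H m
  extend-at-low-vertex 2≤m dv≤2 dx≤ (φ⁻ , cyclic⁻)
    with free-color H⁻ {φ = φ⁻} (deg-removeEdge-end-< H vx (isEnd-right v x) dx≤)
  ... | a , a-free with one-of-two-avoided H⁻ {φ = φ⁻} dv⁻≤1 (csuc≢cpred 2≤m a)
    where dv⁻≤1 = s≤s⁻¹ (deg-removeEdge-end-< H vx (isEnd-left v x) dv≤2)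
  ...   | inj₁ a⁺-free = addEdge-cyclic H vx cyclic⁻ (inj₁ refl) a-free a⁺-free
  ...   | inj₂ a⁻-free = addEdge-cyclic H vx cyclic⁻ (inj₂ (sym (csuc-cpred a))) a-free a⁻-free

  end-deg-on-even : (∀ u → deg H u ≡ 0 ⊎ deg H u ≡ 2) → ∀ {u} → isEnd v x u ≡ true → deg H⁻ u ≡ 1
  end-deg-on-even even {u} u∈ = Sum.[ (λ ()) , suc-injective ]
    (subst (λ d → d ≡ 0 ⊎ d ≡ 2) (deg-removeEdge-end H vx u∈) (even u))

  extend-on-even : (∀ u → deg H u ≡ 0 ⊎ deg H u ≡ 2) → HasCyclicIncColoring H⁻ 1 → HasCyclicIncColoring H 1
  extend-on-even even (φ⁻ , cyclic⁻)
    with countF≥1⇒∃ (adj H⁻ v) (≤-reflexive (sym (end-deg-on-even even (isEnd-left v x))))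
       | countF≥1⇒∃ (adj H⁻ x) (≤-reflexive (sym (end-deg-on-even even (isEnd-right v x))))
  ... | y , vy | z , xz = addEdge-cyclic H vx cyclic⁻ (inj₂ refl) a-free b-free
    where
    dv⁻≡1 = end-deg-on-even even (isEnd-left v x)
    dx⁻≡1 = end-deg-on-even even (isEnd-right v x)
    inner-even : ∀ u → isEnd v x u ≡ false → deg H⁻ u ≡ 0 ⊎ deg H⁻ u ≡ 2
    inner-even u u∉ = subst (λ d → d ≡ 0 ⊎ d ≡ 2) (sym (deg-removeEdge-inner H u∉)) (even u)
    a-free : Avoids H⁻ φ⁻ x (csuc (φ⁻ x z))
    a-free = avoids-beside H⁻ {φ = φ⁻} (≤-reflexive dx⁻≡1) xz (csuc-fixfree (s≤s z≤n) (φ⁻ x z) ∘ sym)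
    b-free : Avoids H⁻ φ⁻ v (φ⁻ x z)
    b-free = avoids-beside H⁻ {φ = φ⁻} (≤-reflexive dv⁻≡1) vy
      (PathEnds.path-ends-differ H⁻ cyclic⁻ inner-even dv⁻≡1 dx⁻≡1 vy xz)

0-or-2 : ∀ {d} → d ≤ 2 → d ≢ 1 → d ≡ 0 ⊎ d ≡ 2
0-or-2 z≤n             _   = inj₁ refl
0-or-2 (s≤s z≤n)       d≢1 = contradiction refl d≢1
0-or-2 (s≤s (s≤s z≤n)) _   = inj₂ refl

cyclic₂-coloring : ∀ {n} (H : Graph n) → (∀ u → deg H u ≤ 2) → HasCyclicIncColoring H 1
cyclic₂-coloring = removeEdge-induction (λ H → (∀ u → deg H u ≤ 2) → HasCyclicIncColoring H 1) step
  where
  step : ∀ {n} (H : Graph n) →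
         (∀ {v x} → Edge H v x → (∀ u → deg (removeEdge H v x) u ≤ 2) →
                     HasCyclicIncColoring (removeEdge H v x) 1) →
         (∀ u → deg H u ≤ 2) → HasCyclicIncColoring H 1
  step H ih Δ≤2 with any? (λ v → deg H v ≟ℕ 1) | edge? H
  ... | yes (v , dv≡1) | _ =
    let x , vx = countF≥1⇒∃ (adj H v) (≤-reflexive (sym dv≡1))
    in extend-at-leaf H vx dv≡1 (Δ≤2 x) (ih vx (removeEdge-maxDegree H Δ≤2))
  ... | no no-leaf | yes (v , x , vx) =
    extend-on-even H vx (λ u → 0-or-2 (Δ≤2 u) (no-leaf ∘ (u ,_))) (ih vx (removeEdge-maxDegree H Δ≤2))
  ... | no _       | no none = edgeless-coloring H none

-- Outerplanar graphs

NonCrossing : ∀ {n} → (Fin n → ℕ) → Graph n → Set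
NonCrossing p H = ∀ a b c d → Edge H a b → Edge H c d → ¬ (p a < p c × p c < p b × p b < p d)

module Chords {n} (H : Graph n) (p : Fin n → ℕ) (p-injective : ∀ {i j} → p i ≡ p j → i ≡ j)
              (noncrossing : NonCrossing p H) where

  LowVertex : Set
  LowVertex = ∃₂ λ v x → Edge H v x × deg H v ≤ 2

  under-chord : ∀ {a b c z} → Edge H a b → p a < p c → p c < p b → Edge H c z → p a ≤ p z × p z ≤ p b
  under-chord {a} {b} {c} {z} ab a<c c<b cz =
      ≮⇒≥ (λ z<a → noncrossing z c a b (edge-sym H cz) ab (z<a , a<c , c<b))
    , ≮⇒≥ (λ b<z → noncrossing a b c z ab cz (a<c , c<b , b<z))

  ordered-pair : (Q : Fin n → Bool) → 2 ≤ countF Q → ∃₂ λ i j → Q i ≡ true × Q j ≡ true × p i < p j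
  ordered-pair Q 2≤Q with countF≥2⇒∃₂ Q 2≤Q
  ... | i , j , i≢j , Qᵢ , Qⱼ with <-cmp (p i) (p j)
  ...   | tri< pᵢ<pⱼ _ _ = i , j , Qᵢ , Qⱼ , pᵢ<pⱼ
  ...   | tri≈ _ pᵢ≡pⱼ _ = contradiction (p-injective pᵢ≡pⱼ) i≢j
  ...   | tri> _ _ pⱼ<pᵢ = j , i , Qⱼ , Qᵢ , pⱼ<pᵢ

  Wedge : Fin n → Set
  Wedge c = ∃₂ λ w₁ w₂ → Edge H c w₁ × Edge H c w₂ × p w₁ < p w₂ × (p c < p w₁ ⊎ p w₂ < p c)

  above below : Fin n → Fin n → Bool
  above c w = adj H c w ∧ does (p c <? p w)
  below c w = adj H c w ∧ does (p w <? p c)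

  deg≤above+below : ∀ c → deg H c ≤ countF (above c) + countF (below c)
  deg≤above+below c = ≤-trans (countF-mono {f = adj H c} {g = λ w → above c w ∨ below c w} side)
                              (countF-∨ (above c) (below c))
    where
    side : ∀ w → adj H c w ≡ true → above c w ∨ below c w ≡ true
    side w cw with <-cmp (p c) (p w)
    ... | tri< c<w _ _ = ∨-introˡ (∧-intro cw (dec-true (p c <? p w) c<w))
    ... | tri≈ _ c≡w _ = contradiction (p-injective c≡w) (edge-irrefl H cw)
    ... | tri> _ _ w<c = ∨-introʳ (∧-intro cw (dec-true (p w <? p c) w<c))

  wedge : ∀ {c} → 2 < deg H c → Wedge c
  wedge {c} 2<deg with countF (above c) ≤? 1
  ... | no  above≰1 =
    let w₁ , w₂ , a₁ , a₂ , w₁<w₂ = ordered-pair (above c) (≰⇒> above≰1)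
    in w₁ , w₂ , proj₁ (∧-elim a₁) , proj₁ (∧-elim a₂) , w₁<w₂ , inj₁ (does⇒ (_ <? _) (proj₂ (∧-elim a₁)))
  ... | yes above≤1 =
    let below≥2 = s≤s⁻¹ (≤-trans 2<deg (≤-trans (deg≤above+below c) (+-monoˡ-≤ _ above≤1)))
        w₁ , w₂ , b₁ , b₂ , w₁<w₂ = ordered-pair (below c) below≥2
    in w₁ , w₂ , proj₁ (∧-elim b₁) , proj₁ (∧-elim b₂) , w₁<w₂ , inj₂ (does⇒ (_ <? _) (proj₂ (∧-elim b₂)))

  -- c is a non-isolated vertex strictly under the chord ab. If deg c > 2, its wedge yields a
  -- strictly shorter chord at c with a neighbour of c under it; s bounds the length p b − p a.
  descend : ∀ s {a b c w} → p b ≤ s + p a → Edge H a b → p a < p c → p c < p b → Edge H c w → LowVertex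
  descend zero    b≤a _  a<c c<b _ = contradiction b≤a (<⇒≱ (<-trans a<c c<b))
  descend (suc s) {a} {b} {c} {w} b≤s+a ab a<c c<b cw with deg H c ≤? 2
  ... | yes c≤2 = c , w , cw , c≤2
  ... | no  c≰2 with wedge (≰⇒> c≰2)
  ...   | w₁ , w₂ , cw₁ , cw₂ , w₁<w₂ , inj₁ c<w₁ =
    descend s (≤-trans (proj₂ (under-chord ab a<c c<b cw₂))
                (≤-trans b≤s+a (≤-trans (≤-reflexive (sym (+-suc s (p a)))) (+-monoʳ-≤ s a<c))))
            cw₂ c<w₁ w₁<w₂ (edge-sym H cw₁)
  ...   | w₁ , w₂ , cw₁ , cw₂ , w₁<w₂ , inj₂ w₂<c =
    descend s (s≤s⁻¹ (≤-trans c<b (≤-trans b≤s+a (+-monoʳ-≤ (suc s) (proj₁ (under-chord ab a<c c<b cw₁))))))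
            (edge-sym H cw₁) w₁<w₂ w₂<c (edge-sym H cw₂)

  low-vertex : ∀ {u w} → Edge H u w → LowVertex
  low-vertex {u} {w} uw with deg H u ≤? 2
  ... | yes u≤2 = u , w , uw , u≤2
  ... | no  u≰2 with wedge (≰⇒> u≰2)
  ...   | w₁ , w₂ , uw₁ , uw₂ , w₁<w₂ , inj₁ u<w₁ =
    descend (p w₂) (m≤m+n (p w₂) (p u)) uw₂ u<w₁ w₁<w₂ (edge-sym H uw₁)
  ...   | w₁ , w₂ , uw₁ , uw₂ , w₁<w₂ , inj₂ w₂<u =
    descend (p u) (m≤m+n (p u) (p w₁)) (edge-sym H uw₁) w₁<w₂ w₂<u (edge-sym H uw₂)

outerplanar-cyclic-coloring : ∀ {n m} (p : Fin n → ℕ) → (∀ {i j} → p i ≡ p j → i ≡ j) → 2 ≤ m →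
                              (H : Graph n) → NonCrossing p H → (∀ u → deg H u ≤ suc m) →
                              HasCyclicIncColoring H m
outerplanar-cyclic-coloring {n} {m} p p-injective 2≤m =
  removeEdge-induction (λ H → NonCrossing p H → (∀ u → deg H u ≤ suc m) → HasCyclicIncColoring H m) step
  where
  step : ∀ H → (∀ {v x} → Edge H v x → NonCrossing p (removeEdge H v x) →
                 (∀ u → deg (removeEdge H v x) u ≤ suc m) → HasCyclicIncColoring (removeEdge H v x) m) →
         NonCrossing p H → (∀ u → deg H u ≤ suc m) → HasCyclicIncColoring H m
  step H ih noncrossing Δ with edge? H
  ... | no none = edgeless-coloring H none
  ... | yes (_ , _ , uw) =
    let v , x , vx , dv≤2 = Chords.low-vertex H p p-injective noncrossing uw
        noncrossing⁻ = λ a b c d ab cd → noncrossing a b c d (removeEdge-⊆ H ab) (removeEdge-⊆ H cd)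
    in extend-at-low-vertex H vx 2≤m dv≤2 (Δ x) (ih vx noncrossing⁻ (removeEdge-maxDegree H Δ))

-- Outerplanar H is, definitionally, NonCrossing for the positions toℕ ∘ (π ⟨$⟩ʳ_).
cyclic-coloring : ∀ {n m} (H : Graph n) → Outerplanar H → 1 ≤ m → (∀ u → deg H u ≤ suc m) →
                  HasCyclicIncColoring H m
cyclic-coloring {m = suc zero}    H _        _ Δ = cyclic₂-coloring H Δ
cyclic-coloring {m = suc (suc _)} H (π , noncrossing) _ Δ =
  outerplanar-cyclic-coloring (λ i → toℕ (π ⟨$⟩ʳ i)) π-injective (s≤s (s≤s z≤n)) H noncrossing Δ
  where
  π-injective : ∀ {i j} → toℕ (π ⟨$⟩ʳ i) ≡ toℕ (π ⟨$⟩ʳ j) → i ≡ j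
  π-injective e = trans (sym (inverseˡ π)) (trans (cong (π ⟨$⟩ˡ_) (toℕ-injective e)) (inverseˡ π))

theorem8 : ∀ (n : ℕ) (G : Graph n) (D : ℕ) → Outerplanar G → IsMaxDegree G D → 2 ≤ D →
    ∀ (d : ℕ) → 2 ≤ d → DefIncChromatic G d D
theorem8 n G (suc m) outerplanar (Δ , u , du≡D) (s≤s 1≤m) d 2≤d
  with cyclic-coloring G outerplanar 1≤m Δ
... | φ , cyclic =
  (φ , cyclic⇒defective G 1≤m 2≤d cyclic) ,
  λ k (ψ , ψ-proper , _) → subst (_≤ k) du≡D (deg≤colors G ψ-proper u)
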